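{- Let $(S_\bot,M)$ be a $C$-monoid where $M$ is an ada, $\theta$ a maximal congruence on $M$, $E_\theta=\{(s,t)\in S_\bot\times S_\bot: \beta[s,t]=\beta[t,t]\text{ for some }\beta\in M\text{ with }(\beta,T)\in\theta\}$ (an equivalence relation on $S_\bot$), $S_\theta=(S_\bot/E_\theta)\setminus\{\overline\bot\}$, and $\rho_\theta:M\to\mathbb{3}^{S_\theta}$ given by $\rho_\theta(T)\equiv T$, $\rho_\theta(F)\equiv F$, and for $\alpha\notin\{T,F\}$, $\rho_\theta(\alpha)(\overline t)=T$ if $(t\circ\alpha,T)\in\theta$, $=F$ if $(t\circ\alpha,F)\in\theta$, $=U$ otherwise. Then for all $\alpha\in M$: (i) if $\rho_\theta(\alpha)$ is the constant map $T$ on $S_\theta$ then $(\alpha,T)\in\theta$; (ii) if $\rho_\theta(\alpha)$ is the constant map $F$ on $S_\theta$ then $(\alpha,F)\in\theta$.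
   Context: A $C$-algebra is an algebra $(M,\vee,\wedge,\neg)$ of type $(2,2,1)$ satisfying, for all $\alpha,\beta,\gamma$: $\neg\neg\alpha=\alpha$; $\neg(\alpha\wedge\beta)=\neg\alpha\vee\neg\beta$; $(\alpha\wedge\beta)\wedge\gamma=\alpha\wedge(\beta\wedge\gamma)$; $\alpha\wedge(\beta\vee\gamma)=(\alpha\wedge\beta)\vee(\alpha\wedge\gamma)$; $(\alpha\vee\beta)\wedge\gamma=(\alpha\wedge\gamma)\vee(\neg\alpha\wedge\beta\wedge\gamma)$; $\alpha\vee(\alpha\wedge\beta)=\alpha$; $(\alpha\wedge\beta)\vee(\beta\wedge\alpha)=(\beta\wedge\alpha)\vee(\alpha\wedge\beta)$. A $C$-algebra with $T,F,U$ has constants $T$ (two-sided identity for $\wedge$), $F$ (two-sided identity for $\vee$), $U$ (fixed point of $\neg$). An ada is a $C$-algebra with $T,F,U$ and a unary operation $(\ )^\downarrow$ with $F^\downarrow=F$, $U^\downarrow=F$, $T^\downarrow=T$, $\alpha\wedge\beta^\downarrow=\alpha\wedge(\alpha\wedge\beta)^\downarrow$, $\alpha^\downarrow\vee\neg(\alpha^\downarrow)=T$, $\alpha=\alpha^\downarrow\vee\alpha$. $\mathbb{3}=\{T,F,U\}$ is McCarthy's three-valued logic. Write $\alpha\llbracket\beta,\gamma\rrbracket=(\alpha\wedge\beta)\vee(\neg\alpha\wedge\gamma)$. A maximal congruence is a congruence on $M$ maximal among those different from $M\times M$. A $C$-set is a pair $(S_\bot,M)$, $S_\bot$ a pointed set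 with base point $\bot$, $M$ a $C$-algebra with $T,F,U$, with a map $(\alpha,s,t)\mapsto\alpha[s,t]$, $M\times S_\bot\times S_\bot\to S_\bot$, such that: $U[s,t]=\bot$; $F[s,t]=t$; $(\neg\alpha)[s,t]=\alpha[t,s]$; $\alpha[\alpha[s,t],u]=\alpha[s,u]$; $\alpha[s,\alpha[t,u]]=\alpha[s,u]$; $(\alpha\wedge\beta)[s,t]=\alpha[\beta[s,t],t]$; $\alpha[\beta[s,t],\beta[u,v]]=\beta[\alpha[s,u],\alpha[t,v]]$; and $\alpha[s,t]=\alpha[t,t]\Rightarrow(\alpha\wedge\beta)[s,t]=(\alpha\wedge\beta)[t,t]$. A $C$-monoid is a $C$-set $(S_\bot,M)$ where $(S_\bot,\cdot)$ is a monoid with identity $1$ and zero $\bot$ (the base point), with a map $\circ:S_\bot\times M\to M$ such that for all $s,t,r,u\in S_\bot,\alpha,\beta\in M$: $\bot\circ\alpha=U$; $t\circ U=U$; $1\circ\alpha=\alpha$; $s\circ(\neg\alpha)=\neg(s\circ\alpha)$; $s\circ(\alpha\wedge\beta)=(s\circ\alpha)\wedge(s\circ\beta)$; $(s\cdot t)\circ\alpha=s\circ(t\circ\alpha)$; $\alpha[s,t]\cdot u=\alpha[s\cdot u,t\cdot u]$; $r\cdot\alpha[s,t]=(r\circ\alpha)[r\cdot s,r\cdot t]$; $\alpha[s,t]\circ\beta=\alpha\llbracket s\circ\beta,t\circ\beta\rrbracket$. -}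

module Defs where

open import Level using (Level; _⊔_; suc)
open import Relation.Binary.PropositionalEquality using (_≡_; _≢_)
open import Relation.Nullary using (¬_)
open import Data.Product using (Σ; _×_; ∃-syntax)
open import Data.Sum using (_⊎_)

record CAlgebraTFU : Set₁ where
  field
    M    : Set
    _∨_  : M → M → M
    _∧_  : M → M → M
    ¬ᶜ_  : M → M
    T F U : M
  infixr 6 _∨_
  infixr 7 _∧_
  infix 8 ¬ᶜ_
  field
    ¬¬        : ∀ a → ¬ᶜ ¬ᶜ a ≡ a
    deMorgan  : ∀ a b → ¬ᶜ (a ∧ b) ≡ ¬ᶜ a ∨ ¬ᶜ b
    ∧-assoc   : ∀ a b c → (a ∧ b) ∧ c ≡ a ∧ (b ∧ c)
    ∧-distribˡ : ∀ a b c → a ∧ (b ∨ c) ≡ (a ∧ b) ∨ (a ∧ c)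
    ∨-∧-distribʳ : ∀ a b c → (a ∨ b) ∧ c ≡ (a ∧ c) ∨ (¬ᶜ a ∧ b ∧ c)
    absorb    : ∀ a b → a ∨ (a ∧ b) ≡ a
    ∧∨-comm   : ∀ a b → (a ∧ b) ∨ (b ∧ a) ≡ (b ∧ a) ∨ (a ∧ b)
    T-identityˡ : ∀ a → T ∧ a ≡ a
    T-identityʳ : ∀ a → a ∧ T ≡ a
    F-identityˡ : ∀ a → F ∨ a ≡ a
    F-identityʳ : ∀ a → a ∨ F ≡ a
    ¬U        : ¬ᶜ U ≡ U

  _⟦_,_⟧ : M → M → M → M
  α ⟦ β , γ ⟧ = (α ∧ β) ∨ (¬ᶜ α ∧ γ)

record Ada : Set₁ where
  field
    calg : CAlgebraTFU
  open CAlgebraTFU calg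
  field
    _↓ : M → M
    F↓ : F ↓ ≡ F
    U↓ : U ↓ ≡ F
    T↓ : T ↓ ≡ T
    ↓-ax1 : ∀ a b → a ∧ (b ↓) ≡ a ∧ ((a ∧ b) ↓)
    ↓-ax2 : ∀ a → (a ↓) ∨ ¬ᶜ (a ↓) ≡ T
    ↓-ax3 : ∀ a → a ≡ (a ↓) ∨ a

record CMonoid (A : CAlgebraTFU) : Set₁ where
  open CAlgebraTFU A
  field
    S   : Set
    bot : S
    _[_,_] : M → S → S → S
    U-sel  : ∀ s t → U [ s , t ] ≡ bot
    F-sel  : ∀ s t → F [ s , t ] ≡ t
    ¬-sel  : ∀ a s t → (¬ᶜ a) [ s , t ] ≡ a [ t , s ]
    sel-l  : ∀ a s t u → a [ a [ s , t ] , u ] ≡ a [ s , u ]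
    sel-r  : ∀ a s t u → a [ s , a [ t , u ] ] ≡ a [ s , u ]
    ∧-sel  : ∀ a b s t → (a ∧ b) [ s , t ] ≡ a [ b [ s , t ] , t ]
    sel-comm : ∀ a b s t u v →
               a [ b [ s , t ] , b [ u , v ] ] ≡ b [ a [ s , u ] , a [ t , v ] ]
    sel-imp : ∀ a b s t → a [ s , t ] ≡ a [ t , t ] →
              (a ∧ b) [ s , t ] ≡ (a ∧ b) [ t , t ]
    _·_ : S → S → S
    one : S
    ·-assoc : ∀ s t u → (s · t) · u ≡ s · (t · u)
    ·-identityˡ : ∀ s → one · s ≡ s
    ·-identityʳ : ∀ s → s · one ≡ s
    ·-zeroˡ : ∀ s → bot · s ≡ bot
    ·-zeroʳ : ∀ s → s · bot ≡ bot
    _∘_ : S → M → M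
    bot∘ : ∀ a → bot ∘ a ≡ U
    ∘U  : ∀ t → t ∘ U ≡ U
    one∘ : ∀ a → one ∘ a ≡ a
    ∘¬  : ∀ s a → s ∘ (¬ᶜ a) ≡ ¬ᶜ (s ∘ a)
    ∘∧  : ∀ s a b → s ∘ (a ∧ b) ≡ (s ∘ a) ∧ (s ∘ b)
    ·∘  : ∀ s t a → (s · t) ∘ a ≡ s ∘ (t ∘ a)
    sel-·ʳ : ∀ a s t u → (a [ s , t ]) · u ≡ a [ s · u , t · u ]
    sel-·ˡ : ∀ r a s t → r · (a [ s , t ]) ≡ (r ∘ a) [ r · s , r · t ]
    sel-∘  : ∀ a s t b → (a [ s , t ]) ∘ b ≡ a ⟦ s ∘ b , t ∘ b ⟧

module _ (A : Ada) where
  open Ada A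
  open CAlgebraTFU calg

  record IsCongruence (θ : M → M → Set) : Set where
    field
      refl′  : ∀ a → θ a a
      sym′   : ∀ {a b} → θ a b → θ b a
      trans′ : ∀ {a b c} → θ a b → θ b c → θ a c
      ∨-cong : ∀ {a b c d} → θ a b → θ c d → θ (a ∨ c) (b ∨ d)
      ∧-cong : ∀ {a b c d} → θ a b → θ c d → θ (a ∧ c) (b ∧ d)
      ¬-cong : ∀ {a b} → θ a b → θ (¬ᶜ a) (¬ᶜ b)
      ↓-cong : ∀ {a b} → θ a b → θ (a ↓) (b ↓)

  IsFull : (M → M → Set) → Set
  IsFull θ = ∀ a b → θ a b

  record IsMaximalCongruence (θ : M → M → Set) : Set₁ where
    field
      isCongruence : IsCongruence θ
      proper       : ¬ IsFull θ
      maximal      : ∀ (ψ : M → M → Set) → IsCongruence ψ → ¬ IsFull ψ →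
                     (∀ a b → θ a b → ψ a b) → ∀ a b → ψ a b → θ a b

data Three : Set where
  T₃ F₃ U₃ : Three

module _ (A : Ada) (SM : CMonoid (Ada.calg A)) (θ : CAlgebraTFU.M (Ada.calg A) → CAlgebraTFU.M (Ada.calg A) → Set) where
  open Ada A
  open CAlgebraTFU calg
  open CMonoid SM

  E : S → S → Set
  E s t = ∃[ β ] (θ β T × β [ s , t ] ≡ β [ t , t ])

  -- graph of ρ_θ(α) evaluated at the class of the representative t:
  -- ρ_θ(α)(t̄) = v
  ρ-graph : M → S → Three → Set
  ρ-graph α t T₃ = α ≡ T ⊎ (α ≢ T × α ≢ F × θ (t ∘ α) T)
  ρ-graph α t F₃ = α ≡ F ⊎ (α ≢ T × α ≢ F × θ (t ∘ α) F)
  ρ-graph α t U₃ = α ≢ T × α ≢ F × ¬ θ (t ∘ α) T × ¬ θ (t ∘ α) F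

  -- ρ_θ(α) is the constant map with value v on S_θ = (S_⊥/E_θ) ∖ {⊥̄}
  ρ-const : M → Three → Set
  ρ-const α v = ∀ t → ¬ E t bot → ρ-graph α t v

-- If β θ T and β[1, ⊥] = β[⊥, ⊥], then acting on any x gives β⟦x, U⟧ = β⟦U, U⟧, and
-- reducing β to T modulo θ yields x θ U for every x; so a proper congruence never
-- identifies the classes of 1 and ⊥. Hence 1 represents an element of S_θ, and a
-- constant value of ρ_θ(α) there is read off 1 ∘ α = α.
module Submission where

open import Defs
open import Data.Product using (_×_; _,_)
open import Data.Sum using (inj₁; inj₂)
open import Relation.Binary.PropositionalEquality
  using (_≡_; refl; sym; trans; cong; cong₂; subst; module ≡-Reasoning)
open import Relation.Nullary using (¬_)

module CAlgebraProperties (C : CAlgebraTFU) where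
  open CAlgebraTFU C
  open ≡-Reasoning

  ¬T≡F : ¬ᶜ T ≡ F
  ¬T≡F = begin
    ¬ᶜ T               ≡⟨ sym (F-identityʳ (¬ᶜ T)) ⟩
    ¬ᶜ T ∨ F           ≡⟨ cong (¬ᶜ T ∨_) (sym (¬¬ F)) ⟩
    ¬ᶜ T ∨ ¬ᶜ ¬ᶜ F     ≡⟨ sym (deMorgan T (¬ᶜ F)) ⟩
    ¬ᶜ (T ∧ ¬ᶜ F)      ≡⟨ cong ¬ᶜ_ (T-identityˡ (¬ᶜ F)) ⟩
    ¬ᶜ ¬ᶜ F            ≡⟨ ¬¬ F ⟩
    F                  ∎

  F-zeroˡ : ∀ a → F ∧ a ≡ F
  F-zeroˡ a = trans (sym (F-identityˡ (F ∧ a))) (absorb F a)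

  T⟦x,y⟧≡x : ∀ x y → T ⟦ x , y ⟧ ≡ x
  T⟦x,y⟧≡x x y = begin
    (T ∧ x) ∨ (¬ᶜ T ∧ y)  ≡⟨ cong₂ _∨_ (T-identityˡ x) (cong (_∧ y) ¬T≡F) ⟩
    x ∨ (F ∧ y)           ≡⟨ cong (x ∨_) (F-zeroˡ y) ⟩
    x ∨ F                 ≡⟨ F-identityʳ x ⟩
    x                     ∎

module CMonoidProperties {C : CAlgebraTFU} (SM : CMonoid C) where
  open CAlgebraTFU C
  open CMonoid SM
  open ≡-Reasoning

  sel-∘-cong : ∀ β {s t s′ t′} x → β [ s , t ] ≡ β [ s′ , t′ ] →
               β ⟦ (s ∘ x) , (t ∘ x) ⟧ ≡ β ⟦ (s′ ∘ x) , (t′ ∘ x) ⟧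
  sel-∘-cong β {s} {t} {s′} {t′} x eq = begin
    β ⟦ (s ∘ x) , (t ∘ x) ⟧      ≡⟨ sym (sel-∘ β s t x) ⟩
    (β [ s , t ]) ∘ x            ≡⟨ cong (_∘ x) eq ⟩
    (β [ s′ , t′ ]) ∘ x          ≡⟨ sel-∘ β s′ t′ x ⟩
    β ⟦ (s′ ∘ x) , (t′ ∘ x) ⟧    ∎

  ⟦x,U⟧≡⟦U,U⟧ : ∀ β → β [ one , bot ] ≡ β [ bot , bot ] → ∀ x → β ⟦ x , U ⟧ ≡ β ⟦ U , U ⟧
  ⟦x,U⟧≡⟦U,U⟧ β eq x = begin
    β ⟦ x , U ⟧                  ≡⟨ sym (cong₂ (β ⟦_,_⟧) (one∘ x) (bot∘ x)) ⟩
    β ⟦ (one ∘ x) , (bot ∘ x) ⟧  ≡⟨ sel-∘-cong β x eq ⟩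
    β ⟦ (bot ∘ x) , (bot ∘ x) ⟧  ≡⟨ cong₂ (β ⟦_,_⟧) (bot∘ x) (bot∘ x) ⟩
    β ⟦ U , U ⟧                  ∎

module CongruenceProperties (A : Ada) {θ : CAlgebraTFU.M (Ada.calg A) → CAlgebraTFU.M (Ada.calg A) → Set}
    (isCongruence : IsCongruence A θ) where
  open Ada A
  open CAlgebraTFU calg
  open CAlgebraProperties calg
  open IsCongruence isCongruence

  ≡⇒θ : ∀ {a b} → a ≡ b → θ a b
  ≡⇒θ {a} refl = refl′ a

  θT⇒⟦x,y⟧θx : ∀ {β} → θ β T → ∀ x y → θ (β ⟦ x , y ⟧) x
  θT⇒⟦x,y⟧θx θβT x y =
    trans′ (∨-cong (∧-cong θβT (refl′ x)) (∧-cong (¬-cong θβT) (refl′ y))) (≡⇒θ (T⟦x,y⟧≡x x y))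

module _ (A : Ada) (SM : CMonoid (Ada.calg A))
    {θ : CAlgebraTFU.M (Ada.calg A) → CAlgebraTFU.M (Ada.calg A) → Set}
    (isCongruence : IsCongruence A θ) where
  open Ada A
  open CAlgebraTFU calg
  open CMonoid SM
  open CMonoidProperties SM
  open CongruenceProperties A isCongruence
  open IsCongruence isCongruence

  E-one-bot⇒full : E A SM θ one bot → IsFull A θ
  E-one-bot⇒full (β , θβT , eq) a b = trans′ (θU a) (sym′ (θU b))
    where
    θU : ∀ x → θ x U
    θU x = trans′ (sym′ (θT⇒⟦x,y⟧θx θβT x U))
             (trans′ (≡⇒θ (⟦x,U⟧≡⟦U,U⟧ β eq x)) (θT⇒⟦x,y⟧θx θβT U U))

  ρ-graph-one-T : ∀ α → ρ-graph A SM θ α one T₃ → θ α T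
  ρ-graph-one-T α (inj₁ refl)          = refl′ T
  ρ-graph-one-T α (inj₂ (_ , _ , θ1α)) = subst (λ x → θ x T) (one∘ α) θ1α

  ρ-graph-one-F : ∀ α → ρ-graph A SM θ α one F₃ → θ α F
  ρ-graph-one-F α (inj₁ refl)          = refl′ F
  ρ-graph-one-F α (inj₂ (_ , _ , θ1α)) = subst (λ x → θ x F) (one∘ α) θ1α

proposition3p7 : (A : Ada) (SM : CMonoid (Ada.calg A))
    (θ : CAlgebraTFU.M (Ada.calg A) → CAlgebraTFU.M (Ada.calg A) → Set) →
    IsMaximalCongruence A θ →
    ∀ α →
    (ρ-const A SM θ α T₃ → θ α (CAlgebraTFU.T (Ada.calg A))) ×
    (ρ-const A SM θ α F₃ → θ α (CAlgebraTFU.F (Ada.calg A)))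
proposition3p7 A SM θ mc α =
    (λ constT → ρ-graph-one-T A SM isCongruence α (constT (CMonoid.one SM) one≁bot))
  , (λ constF → ρ-graph-one-F A SM isCongruence α (constF (CMonoid.one SM) one≁bot))
  where
  open IsMaximalCongruence mc using (isCongruence; proper)
  one≁bot : ¬ E A SM θ (CMonoid.one SM) (CMonoid.bot SM)
  one≁bot e = proper (E-one-bot⇒full A SM isCongruence e)
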